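{- Let $\mathcal{C}$ be a set of $4$-dimensional subspaces of $\mathbb{F}_2^8$ with pairwise subspace distance at least $6$ and $\#\mathcal{C}\ge 255$. Then for each hyperplane $H$ of $\mathbb{F}_2^8$ there is a point $P'\not\le H$ with $\#\mathcal{I}_{\mathcal{C}}(P')\ge 14$. Moreover, if $\#\mathcal{I}_{\mathcal{C}}(P)\le 16$ for all points $P$, then for each hyperplane $H$ there is a point $P''\not\le H$ with $\#\mathcal{I}_{\mathcal{C}}(P'')\ge 15$.
   Context: The subspace distance is $\mathrm{d}_{\mathrm{s}}(U,W)=\dim(U+W)-\dim(U\cap W)$. Points are $1$-dimensional subspaces. For a subspace $X$, $\mathcal{I}_{\mathcal{C}}(X)=\{U\in\mathcal{C} : U\le X \text{ or } X\le U\}$. -}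

module Defs where

open import Data.Bool using (Bool; true; false; _∧_; _∨_; not; _xor_)
open import Data.Nat using (ℕ; zero; suc; _+_; _≤_)
open import Data.Fin using (Fin)
open import Data.Vec using (Vec; []; _∷_; replicate; zipWith)
open import Data.List using (List; []; _∷_; _++_; map; length; filter; lookup)
open import Data.Bool.ListAction using (any; all)
open import Data.Product using (Σ; ∃; _×_; _,_)
open import Relation.Binary.PropositionalEquality using (_≡_; _≢_)
open import Relation.Nullary using (¬_)
open import Relation.Nullary.Decidable using (does)
open import Data.Bool.Properties using () renaming (_≟_ to _≟ᵇ_)
open import Function using (_⇔_)

V : ℕ → Set
V n = Vec Bool n

zeroV : ∀ {n} → V n
zeroV = replicate _ false

_+V_ : ∀ {n} → V n → V n → V n
_+V_ = zipWith _xor_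

allVecs : (n : ℕ) → List (V n)
allVecs zero = [] ∷ []
allVecs (suc n) = map (false ∷_) (allVecs n) ++ map (true ∷_) (allVecs n)

SubsetV : ℕ → Set
SubsetV n = V n → Bool

-- U is a subspace of F₂ⁿ (over F₂, closure under addition suffices)
record IsSubspace {n : ℕ} (U : SubsetV n) : Set where
  field
    has-zero : U zeroV ≡ true
    add-closed : ∀ u w → U u ≡ true → U w ≡ true → U (u +V w) ≡ true

lincomb : ∀ {n k} → Vec Bool k → Vec (V n) k → V n
lincomb [] [] = zeroV
lincomb (c ∷ cs) (b ∷ bs) = (if′ c b) +V lincomb cs bs
  where
  if′ : Bool → V _ → V _
  if′ true v = v
  if′ false v = zeroV

LinIndep : ∀ {n k} → Vec (V n) k → Set
LinIndep {k = k} bs = ∀ c → lincomb c bs ≡ zeroV → c ≡ replicate k false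

IsBasis : ∀ {n k} → SubsetV n → Vec (V n) k → Set
IsBasis U bs = LinIndep bs × (∀ v → (U v ≡ true) ⇔ (∃ λ c → lincomb c bs ≡ v))

HasDim : ∀ {n} → SubsetV n → ℕ → Set
HasDim {n} U k = Σ (Vec (V n) k) (IsBasis U)

_⊕_ : ∀ {n} → SubsetV n → SubsetV n → SubsetV n
_⊕_ {n} U W v = any (λ u → U u ∧ W (v +V u)) (allVecs n)

_∩_ : ∀ {n} → SubsetV n → SubsetV n → SubsetV n
(U ∩ W) v = U v ∧ W v

_≤S_ : ∀ {n} → SubsetV n → SubsetV n → Set
U ≤S X = ∀ v → U v ≡ true → X v ≡ true

_≤ᵇ_ : ∀ {n} → SubsetV n → SubsetV n → Bool
_≤ᵇ_ {n} U X = all (λ v → not (U v) ∨ X v) (allVecs n)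

-- d_s(U,W) ≥ d : dim(U+W) − dim(U∩W) ≥ d
DistAtLeast : ∀ {n} → ℕ → SubsetV n → SubsetV n → Set
DistAtLeast d U W = ∀ a b → HasDim (U ⊕ W) a → HasDim (U ∩ W) b → d + b ≤ a

countI : ∀ {n} → List (SubsetV n) → SubsetV n → ℕ
countI C X = length (filter (λ U → (U ≤ᵇ X ∨ X ≤ᵇ U) ≟ᵇ true) C)

IsPoint : ∀ {n} → SubsetV n → Set
IsPoint P = IsSubspace P × HasDim P 1

IsHyperplane8 : SubsetV 8 → Set
IsHyperplane8 H = IsSubspace H × HasDim H 7

-- C (given as a list indexed by Fin (length C)) is a set of 4-dim subspaces of F₂⁸
-- with pairwise subspace distance ≥ 6 (which also forces the entries to be distinct)
IsCode : List (SubsetV 8) → Set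
IsCode C = (∀ i → IsSubspace (lookup C i) × HasDim (lookup C i) 4)
         × (∀ i j → i ≢ j → DistAtLeast 6 (lookup C i) (lookup C j))

-- Two codewords share at most one nonzero vector: if U ∩ W contained two independent
-- vectors, extending a basis of U ∩ W to bases of U and W would give
-- d_s(U, W) ≤ dim U + dim W − 2 dim(U ∩ W) ≤ 4 + 4 − 4 < 6.
-- So the codewords lying in a hyperplane H cover its 127 nonzero vectors by 15-sets
-- meeting pairwise in at most one vector, and a second-moment count (8r ≤ r² + 16 at
-- every vector) allows at most 25 of them. Each of the remaining ≥ 230 codewords has
-- at least 8 of its 16 vectors outside H, since translating by one of them maps the
-- part inside H injectively to the part outside. These ≥ 1840 incidences are spread
-- over the 128 vectors outside H, so one of them, v, lies in at least 15 codewords,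
-- and every codeword containing v contains the point ⟨v⟩.

module Submission where

open import Defs
open import Data.Bool using (Bool; true; false; _∧_; _∨_; not; _xor_)
import Data.Bool.Properties as Bool
open import Data.Nat using (ℕ; zero; suc; _+_; _*_; _^_; _≤_; _<_; z≤n; s≤s)
open import Data.Nat.Properties
open import Data.Nat.Solver using (module +-*-Solver)
open +-*-Solver using (solve; _:+_; _:*_; _:=_; con)
open import Algebra.Properties.CommutativeSemigroup +-commutativeSemigroup using () renaming (interchange to +-interchange)
open import Data.Vec using (Vec; []; _∷_; replicate; splitAt) renaming (_++_ to _++ᵛ_)
import Data.Vec.Properties as Vec
open import Data.Vec.Relation.Unary.All using (All; []; _∷_)
import Data.Vec.Relation.Unary.All as VAll
open import Data.Fin using (Fin)
import Data.Fin.Properties as Fin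
open import Data.List using (List; []; _∷_; map; length; filter; take; lookup; allFin) renaming (_++_ to _++ˡ_)
open import Data.List.Properties using (length-++; length-map; length-removeAt′; length-take; length-tabulate; map-tabulate; tabulate-lookup)
import Data.List.Relation.Binary.Sublist.Propositional as Sublist
open import Data.List.Relation.Binary.Sublist.Propositional.Properties using (take-⊆)
open import Data.List.Membership.Propositional using (_∈_; find; lose)
open import Data.List.Membership.Propositional.Properties using (∈-map⁺; ∈-map⁻; ∈-++⁺ˡ; ∈-++⁺ʳ; ∈-filter⁺; ∈-filter⁻)
open import Data.List.Relation.Unary.Any as Any using (here; there; any?; _─_)
import Data.List.Relation.Unary.Any.Properties as AnyP
import Data.List.Relation.Unary.All as All
import Data.List.Relation.Unary.All.Properties as AllP
open import Data.Bool.ListAction using (any; all)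
open import Data.List.Relation.Unary.Unique.Propositional using (Unique)
import Data.List.Relation.Unary.Unique.Propositional.Properties as Unique
open import Data.List.Relation.Unary.AllPairs using ([]; _∷_)
open import Data.Product using (∃; ∃₂; _×_; _,_; proj₁; proj₂)
open import Data.Sum using (_⊎_; inj₁; inj₂; [_,_]′)
open import Data.Empty using (⊥; ⊥-elim)
open import Function using (_⇔_; mk⇔; _∘_; id; Equivalence)
open import Relation.Binary.PropositionalEquality using (_≡_; _≢_; refl; sym; trans; cong; cong₂; subst; subst₂; module ≡-Reasoning)
open import Relation.Nullary using (¬_; Dec; yes; no; contradiction)
open import Relation.Nullary.Decidable using (does; map′; dec-true)
open import Relation.Binary.Definitions using (DecidableEquality)

private
  variable
    n k m : ℕ
    A B : Set

+V-assoc : (x y z : V n) → (x +V y) +V z ≡ x +V (y +V z)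
+V-assoc = Vec.zipWith-assoc Bool.xor-assoc

+V-comm : (x y : V n) → x +V y ≡ y +V x
+V-comm = Vec.zipWith-comm Bool.xor-comm

+V-identityˡ : (x : V n) → zeroV +V x ≡ x
+V-identityˡ = Vec.zipWith-identityˡ Bool.xor-identityˡ

+V-identityʳ : (x : V n) → x +V zeroV ≡ x
+V-identityʳ = Vec.zipWith-identityʳ Bool.xor-identityʳ

+V-self : (x : V n) → x +V x ≡ zeroV
+V-self [] = refl
+V-self (a ∷ x) = cong₂ _∷_ (Bool.xor-same a) (+V-self x)

+V-self-cancelˡ : (x y : V n) → x +V (x +V y) ≡ y
+V-self-cancelˡ x y = begin
  x +V (x +V y)   ≡⟨ +V-assoc x x y ⟨
  (x +V x) +V y   ≡⟨ cong (_+V y) (+V-self x) ⟩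
  zeroV +V y      ≡⟨ +V-identityˡ y ⟩
  y               ∎
  where open ≡-Reasoning

+V-absorbˡ : (x y : V n) → (x +V y) +V x ≡ y
+V-absorbˡ x y = trans (+V-comm (x +V y) x) (+V-self-cancelˡ x y)

+V-absorbʳ : (x y : V n) → x +V (y +V x) ≡ y
+V-absorbʳ x y = trans (cong (x +V_) (+V-comm y x)) (+V-self-cancelˡ x y)

+V-cancelˡ-≡ : (x y z : V n) → x +V y ≡ x +V z → y ≡ z
+V-cancelˡ-≡ x y z e = trans (sym (+V-self-cancelˡ x y)) (trans (cong (x +V_) e) (+V-self-cancelˡ x z))

+V≡0⇒≡ : (x y : V n) → x +V y ≡ zeroV → x ≡ y
+V≡0⇒≡ x y e = sym (+V-cancelˡ-≡ x y x (trans e (sym (+V-self x))))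

+V-interchange : (a b c d : V n) → (a +V b) +V (c +V d) ≡ (a +V c) +V (b +V d)
+V-interchange a b c d = begin
  (a +V b) +V (c +V d)  ≡⟨ +V-assoc a b (c +V d) ⟩
  a +V (b +V (c +V d))  ≡⟨ cong (a +V_) (+V-assoc b c d) ⟨
  a +V ((b +V c) +V d)  ≡⟨ cong (λ z → a +V (z +V d)) (+V-comm b c) ⟩
  a +V ((c +V b) +V d)  ≡⟨ cong (a +V_) (+V-assoc c b d) ⟩
  a +V (c +V (b +V d))  ≡⟨ +V-assoc a c (b +V d) ⟨
  (a +V c) +V (b +V d)  ∎
  where open ≡-Reasoning

_≟V_ : (x y : V n) → Dec (x ≡ y)
_≟V_ = Vec.≡-dec Bool._≟_

∈-allVecs : (v : V n) → v ∈ allVecs n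
∈-allVecs [] = here refl
∈-allVecs {suc n} (false ∷ v) = ∈-++⁺ˡ (∈-map⁺ (false ∷_) (∈-allVecs v))
∈-allVecs {suc n} (true ∷ v) = ∈-++⁺ʳ (map (false ∷_) (allVecs n)) (∈-map⁺ (true ∷_) (∈-allVecs v))

allVecs-unique : ∀ n → Unique (allVecs n)
allVecs-unique zero = All.[] ∷ []
allVecs-unique (suc n) =
  Unique.++⁺ (Unique.map⁺ Vec.∷-injectiveʳ (allVecs-unique n))
             (Unique.map⁺ Vec.∷-injectiveʳ (allVecs-unique n))
             λ (f∈ , t∈) → let _ , _ , v≡f∷ = ∈-map⁻ (false ∷_) f∈
                               _ , _ , v≡t∷ = ∈-map⁻ (true ∷_) t∈
                           in false≢true (Vec.∷-injectiveˡ (trans (sym v≡f∷) v≡t∷))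
  where
  false≢true : false ≢ true
  false≢true ()

length-allVecs : ∀ n → length (allVecs n) ≡ 2 ^ n
length-allVecs zero = refl
length-allVecs (suc n) = begin
  length (map (false ∷_) (allVecs n) ++ˡ map (true ∷_) (allVecs n))
    ≡⟨ length-++ (map (false ∷_) (allVecs n)) ⟩
  length (map (false ∷_) (allVecs n)) + length (map (true ∷_) (allVecs n))
    ≡⟨ cong₂ _+_ (length-map _ (allVecs n)) (length-map _ (allVecs n)) ⟩
  length (allVecs n) + length (allVecs n)
    ≡⟨ cong (λ l → l + l) (length-allVecs n) ⟩
  2 ^ n + 2 ^ n
    ≡⟨ cong (2 ^ n +_) (+-identityʳ (2 ^ n)) ⟨
  2 ^ suc n ∎
  where open ≡-Reasoning

module _ {A : Set} (p : A → Bool) where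

  any-intro : ∀ {x xs} → x ∈ xs → p x ≡ true → any p xs ≡ true
  any-intro x∈xs px = Equivalence.to Bool.T-≡ (AnyP.any⁺ p (lose x∈xs (Equivalence.from Bool.T-≡ px)))

  any-elim : ∀ xs → any p xs ≡ true → ∃ λ x → x ∈ xs × p x ≡ true
  any-elim xs e = let x , x∈xs , px = find (AnyP.any⁻ p xs (Equivalence.from Bool.T-≡ e))
                  in x , x∈xs , Equivalence.to Bool.T-≡ px

  all-intro : ∀ xs → (∀ {x} → x ∈ xs → p x ≡ true) → all p xs ≡ true
  all-intro xs h = Equivalence.to Bool.T-≡ (AllP.all⁻ p (All.tabulate (λ x∈xs → Equivalence.from Bool.T-≡ (h x∈xs))))

  all-elim : ∀ {x xs} → all p xs ≡ true → x ∈ xs → p x ≡ true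
  all-elim {xs = xs} e x∈xs = Equivalence.to Bool.T-≡ (All.lookup (AllP.all⁺ p xs (Equivalence.from Bool.T-≡ e)) x∈xs)

  all≡false⇒∃ : ∀ xs → all p xs ≡ false → ∃ λ x → p x ≡ false
  all≡false⇒∃ (x ∷ xs) e with p x in px
  ... | true = all≡false⇒∃ xs e
  ... | false = x , px

-- Linear combinations and bases

infixr 30 _·_
_·_ : Bool → V n → V n
true · v = v
false · v = zeroV

lincomb-∷ : ∀ c (cs : Vec Bool k) (b : V n) bs → lincomb (c ∷ cs) (b ∷ bs) ≡ c · b +V lincomb cs bs
lincomb-∷ true _ _ _ = refl
lincomb-∷ false _ _ _ = refl

·-distribʳ-xor : ∀ c d (b : V n) → (c xor d) · b ≡ c · b +V d · b
·-distribʳ-xor true true b = sym (+V-self b)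
·-distribʳ-xor true false b = sym (+V-identityʳ b)
·-distribʳ-xor false true b = sym (+V-identityˡ b)
·-distribʳ-xor false false b = sym (+V-identityˡ zeroV)

lincomb-zero : (bs : Vec (V n) k) → lincomb (replicate k false) bs ≡ zeroV
lincomb-zero [] = refl
lincomb-zero (b ∷ bs) = trans (+V-identityˡ _) (lincomb-zero bs)

lincomb-+ : (c d : Vec Bool k) (bs : Vec (V n) k) → lincomb (c +V d) bs ≡ lincomb c bs +V lincomb d bs
lincomb-+ [] [] [] = sym (+V-self zeroV)
lincomb-+ (c₀ ∷ c) (d₀ ∷ d) (b ∷ bs) = begin
  lincomb ((c₀ xor d₀) ∷ (c +V d)) (b ∷ bs)              ≡⟨ lincomb-∷ (c₀ xor d₀) (c +V d) b bs ⟩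
  (c₀ xor d₀) · b +V lincomb (c +V d) bs                  ≡⟨ cong₂ _+V_ (·-distribʳ-xor c₀ d₀ b) (lincomb-+ c d bs) ⟩
  (c₀ · b +V d₀ · b) +V (lincomb c bs +V lincomb d bs)    ≡⟨ +V-interchange _ _ _ _ ⟩
  (c₀ · b +V lincomb c bs) +V (d₀ · b +V lincomb d bs)    ≡⟨ cong₂ _+V_ (lincomb-∷ c₀ c b bs) (lincomb-∷ d₀ d b bs) ⟨
  lincomb (c₀ ∷ c) (b ∷ bs) +V lincomb (d₀ ∷ d) (b ∷ bs)  ∎
  where open ≡-Reasoning

lincomb-++ : (c : Vec Bool k) (d : Vec Bool m) (bs : Vec (V n) k) (cs : Vec (V n) m) →
             lincomb (c ++ᵛ d) (bs ++ᵛ cs) ≡ lincomb c bs +V lincomb d cs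
lincomb-++ [] d [] cs = sym (+V-identityˡ _)
lincomb-++ (c₀ ∷ c) d (b ∷ bs) cs = begin
  lincomb (c₀ ∷ c ++ᵛ d) (b ∷ bs ++ᵛ cs)         ≡⟨ lincomb-∷ c₀ (c ++ᵛ d) b (bs ++ᵛ cs) ⟩
  c₀ · b +V lincomb (c ++ᵛ d) (bs ++ᵛ cs)        ≡⟨ cong (c₀ · b +V_) (lincomb-++ c d bs cs) ⟩
  c₀ · b +V (lincomb c bs +V lincomb d cs)       ≡⟨ +V-assoc _ _ _ ⟨
  (c₀ · b +V lincomb c bs) +V lincomb d cs       ≡⟨ cong (_+V lincomb d cs) (lincomb-∷ c₀ c b bs) ⟨
  lincomb (c₀ ∷ c) (b ∷ bs) +V lincomb d cs      ∎
  where open ≡-Reasoning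

lincomb-injective : {bs : Vec (V n) k} → LinIndep bs → ∀ c d → lincomb c bs ≡ lincomb d bs → c ≡ d
lincomb-injective {bs = bs} indep c d e = +V≡0⇒≡ c d (indep (c +V d)
  (trans (lincomb-+ c d bs) (trans (cong (_+V lincomb d bs) e) (+V-self _))))

lincomb-closed : ∀ {S : SubsetV n} → IsSubspace S → {bs : Vec (V n) k} →
                 All (λ b → S b ≡ true) bs → ∀ c → S (lincomb c bs) ≡ true
lincomb-closed S-sub [] [] = IsSubspace.has-zero S-sub
lincomb-closed S-sub (Sb ∷ Sbs) (true ∷ c) = IsSubspace.add-closed S-sub _ _ Sb (lincomb-closed S-sub Sbs c)
lincomb-closed S-sub (Sb ∷ Sbs) (false ∷ c) =
  IsSubspace.add-closed S-sub _ _ (IsSubspace.has-zero S-sub) (lincomb-closed S-sub Sbs c)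

Span : Vec (V n) k → V n → Set
Span bs v = ∃ λ c → lincomb c bs ≡ v

span? : (bs : Vec (V n) k) (v : V n) → Dec (Span bs v)
span? {k = k} bs v = map′ (λ a → let c , _ , e = find a in c , e) (λ (c , e) → lose (∈-allVecs c) e)
  (any? (λ c → lincomb c bs ≟V v) (allVecs k))

span-head : (b : V n) (bs : Vec (V n) k) → Span (b ∷ bs) b
span-head {k = k} b bs = true ∷ replicate k false , trans (cong (b +V_) (lincomb-zero bs)) (+V-identityʳ b)

span-tail : (b : V n) {bs : Vec (V n) k} {v : V n} → Span bs v → Span (b ∷ bs) v
span-tail b (c , e) = false ∷ c , trans (+V-identityˡ _) e

basis-All : {S : SubsetV n} {bs : Vec (V n) k} → IsBasis S bs → All (λ b → S b ≡ true) bs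
basis-All {n = n} {S = S} {bs} (_ , spans) = spanned⇒All bs (λ c → Equivalence.from (spans _) (c , refl))
  where
  spanned⇒All : ∀ {k} (bs : Vec (V n) k) → (∀ c → S (lincomb c bs) ≡ true) → All (λ b → S b ≡ true) bs
  spanned⇒All [] _ = []
  spanned⇒All (b ∷ bs) S∋ = S∋span (span-head b bs) ∷ spanned⇒All bs (λ c → S∋span (span-tail b (c , refl)))
    where
    S∋span : ∀ {v} → Span (b ∷ bs) v → S v ≡ true
    S∋span (c , e) = subst (λ v → S v ≡ true) e (S∋ c)

LinIndep-∷ : {x : V n} {bs : Vec (V n) k} → LinIndep bs → ¬ Span bs x → LinIndep (x ∷ bs)
LinIndep-∷ {x = x} indep x∉ (true ∷ c) e = ⊥-elim (x∉ (c , sym (+V≡0⇒≡ x _ e)))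
LinIndep-∷ indep x∉ (false ∷ c) e = cong (false ∷_) (indep c (trans (sym (+V-identityˡ _)) e))

module BasisExtension {S : SubsetV n} (S-sub : IsSubspace S) (bs : Vec (V n) k) where

  InS : ∀ {m} → Vec (V n) m → Set
  InS = All (λ b → S b ≡ true)

  record Extension (xs : List (V n)) {m} (es : Vec (V n) m) : Set where
    field
      {size}      : ℕ
      new         : Vec (V n) size
      independent : LinIndep (new ++ᵛ bs)
      inside      : InS (new ++ᵛ bs)
      keeps       : ∀ {v} → Span (es ++ᵛ bs) v → Span (new ++ᵛ bs) v
      covers      : ∀ {v} → v ∈ xs → S v ≡ true → Span (new ++ᵛ bs) v

  consider : ∀ {x xs m l} {es : Vec (V n) m} {es′ : Vec (V n) l} →
             (∀ {v} → Span (es ++ᵛ bs) v → Span (es′ ++ᵛ bs) v) → (rest : Extension xs es′) →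
             (S x ≡ true → Span (Extension.new rest ++ᵛ bs) x) → Extension (x ∷ xs) es
  consider grow rest covers-x = record
    { new = new ; independent = independent ; inside = inside ; keeps = keeps ∘ grow
    ; covers = λ { (here refl) → covers-x ; (there v∈xs) → covers v∈xs } }
    where open Extension rest

  extend : (xs : List (V n)) {m : ℕ} (es : Vec (V n) m) → LinIndep (es ++ᵛ bs) → InS (es ++ᵛ bs) → Extension xs es
  extend [] es indep inS = record
    { new = es ; independent = indep ; inside = inS ; keeps = λ sp → sp ; covers = λ () }
  extend (x ∷ xs) es indep inS with S x in Sx | span? (es ++ᵛ bs) x
  ... | false | _ = consider (λ sp → sp) (extend xs es indep inS) (λ Sx′ → contradiction (trans (sym Sx′) Sx) λ ())
  ... | true | yes spanned = consider (λ sp → sp) rest (λ _ → keeps spanned)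
    where rest = extend xs es indep inS
          open Extension rest
  ... | true | no unspanned = consider (span-tail x) rest (λ _ → keeps (span-head x _))
    where rest = extend xs (x ∷ es) (LinIndep-∷ indep unspanned) (Sx ∷ inS)
          open Extension rest

  extend-to-basis : LinIndep bs → InS bs → ∃₂ λ m (es : Vec (V n) m) → IsBasis S (es ++ᵛ bs)
  extend-to-basis indep inS = size , new , independent ,
    λ v → mk⇔ (covers (∈-allVecs v)) (λ (c , e) → subst (λ w → S w ≡ true) e (lincomb-closed S-sub inside c))
    where open Extension (extend (allVecs n) [] indep inS)

basis-exists : {S : SubsetV n} → IsSubspace S → ∃ (HasDim S)
basis-exists S-sub with BasisExtension.extend-to-basis S-sub [] (λ { [] _ → refl }) []
... | m , es , basis = m + 0 , es ++ᵛ [] , basis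

χ : Bool → ℕ
χ true = 1
χ false = 0

χ-∧ : ∀ a b → χ (a ∧ b) ≡ χ a * χ b
χ-∧ true b = sym (+-identityʳ (χ b))
χ-∧ false b = refl

∑ : List A → (A → ℕ) → ℕ
∑ [] f = 0
∑ (x ∷ xs) f = f x + ∑ xs f

∑-cong : ∀ (xs : List A) {f g : A → ℕ} → (∀ x → f x ≡ g x) → ∑ xs f ≡ ∑ xs g
∑-cong [] _ = refl
∑-cong (x ∷ xs) f≡g = cong₂ _+_ (f≡g x) (∑-cong xs f≡g)

∑-mono-≤ : ∀ (xs : List A) {f g : A → ℕ} → (∀ {x} → x ∈ xs → f x ≤ g x) → ∑ xs f ≤ ∑ xs g
∑-mono-≤ [] _ = z≤n
∑-mono-≤ (x ∷ xs) f≤g = +-mono-≤ (f≤g (here refl)) (∑-mono-≤ xs (f≤g ∘ there))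

∑-+ : ∀ (xs : List A) (f g : A → ℕ) → ∑ xs (λ x → f x + g x) ≡ ∑ xs f + ∑ xs g
∑-+ [] f g = refl
∑-+ (x ∷ xs) f g = trans (cong (f x + g x +_) (∑-+ xs f g)) (+-interchange (f x) (g x) (∑ xs f) (∑ xs g))

∑-*ˡ : ∀ (xs : List A) c (f : A → ℕ) → ∑ xs (λ x → c * f x) ≡ c * ∑ xs f
∑-*ˡ [] c f = sym (*-zeroʳ c)
∑-*ˡ (x ∷ xs) c f = trans (cong (c * f x +_) (∑-*ˡ xs c f)) (sym (*-distribˡ-+ c (f x) _))

∑-*ʳ : ∀ (xs : List A) c (f : A → ℕ) → ∑ xs (λ x → f x * c) ≡ ∑ xs f * c
∑-*ʳ xs c f = trans (∑-cong xs (λ x → *-comm (f x) c)) (trans (∑-*ˡ xs c f) (*-comm c _))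

∑-const : ∀ (xs : List A) c → ∑ xs (λ _ → c) ≡ c * length xs
∑-const [] c = sym (*-zeroʳ c)
∑-const (x ∷ xs) c = trans (cong (c +_) (∑-const xs c)) (sym (*-suc c (length xs)))

∑-zero : ∀ (xs : List A) → ∑ xs (λ _ → 0) ≡ 0
∑-zero xs = ∑-const xs 0

∑-swap : (xs : List A) (ys : List B) (f : A → B → ℕ) →
         ∑ xs (λ x → ∑ ys (f x)) ≡ ∑ ys (λ y → ∑ xs (λ x → f x y))
∑-swap [] ys f = sym (∑-zero ys)
∑-swap (x ∷ xs) ys f = trans (cong (∑ ys (f x) +_) (∑-swap xs ys f)) (sym (∑-+ ys (f x) _))

∑-map : (g : B → A) (ys : List B) (f : A → ℕ) → ∑ (map g ys) f ≡ ∑ ys (f ∘ g)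
∑-map g [] f = refl
∑-map g (y ∷ ys) f = cong (f (g y) +_) (∑-map g ys f)

∑-<⇒∃< : ∀ (xs : List A) (f g : A → ℕ) → ∑ xs f < ∑ xs g → ∃ λ x → x ∈ xs × f x < g x
∑-<⇒∃< (x ∷ xs) f g ∑f<∑g with f x <? g x
... | yes fx<gx = x , here refl , fx<gx
... | no fx≮gx = let y , y∈xs , fy<gy = ∑-<⇒∃< xs f g
                       (+-cancelˡ-< (f x) _ _ (<-≤-trans ∑f<∑g (+-monoˡ-≤ (∑ xs g) (≮⇒≥ fx≮gx))))
                 in y , there y∈xs , fy<gy

from-does : (a? : Dec B) → does a? ≡ true → B
from-does (yes b) _ = b

-- Chosen so that countI C X is count (λ U → U ≤ᵇ X ∨ X ≤ᵇ U) C by definition.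
count : (A → Bool) → List A → ℕ
count p xs = length (filter (λ x → p x Bool.≟ true) xs)

count≡∑χ : ∀ (p : A → Bool) (xs : List A) → count p xs ≡ ∑ xs (χ ∘ p)
count≡∑χ p [] = refl
count≡∑χ p (x ∷ xs) with p x
... | true = cong suc (count≡∑χ p xs)
... | false = count≡∑χ p xs

count-complement : (p : A → Bool) (xs : List A) → count p xs + count (not ∘ p) xs ≡ length xs
count-complement p xs = begin
  count p xs + count (not ∘ p) xs            ≡⟨ cong₂ _+_ (count≡∑χ p xs) (count≡∑χ (not ∘ p) xs) ⟩
  ∑ xs (χ ∘ p) + ∑ xs (χ ∘ not ∘ p)          ≡⟨ ∑-+ xs _ _ ⟨
  ∑ xs (λ x → χ (p x) + χ (not (p x)))       ≡⟨ ∑-cong xs (λ x → χ+χnot (p x)) ⟩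
  ∑ xs (λ _ → 1)                             ≡⟨ trans (∑-const xs 1) (*-identityˡ _) ⟩
  length xs                                  ∎
  where
  open ≡-Reasoning
  χ+χnot : ∀ b → χ b + χ (not b) ≡ 1
  χ+χnot true = refl
  χ+χnot false = refl

count-lookup : (p : A → Bool) (xs : List A) → count p xs ≡ ∑ (allFin (length xs)) (χ ∘ p ∘ lookup xs)
count-lookup p xs = begin
  count p xs                                          ≡⟨ count≡∑χ p xs ⟩
  ∑ xs (χ ∘ p)                                        ≡⟨ cong (λ ys → ∑ ys (χ ∘ p)) tabulated ⟨
  ∑ (map (lookup xs) (allFin (length xs))) (χ ∘ p)    ≡⟨ ∑-map (lookup xs) (allFin (length xs)) (χ ∘ p) ⟩
  ∑ (allFin (length xs)) (χ ∘ p ∘ lookup xs)          ∎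
  where
  open ≡-Reasoning
  tabulated : map (lookup xs) (allFin (length xs)) ≡ xs
  tabulated = trans (map-tabulate id (lookup xs)) (tabulate-lookup xs)

∈-─ : ∀ {x z} {ys : List A} (x∈ys : x ∈ ys) → z ∈ ys → z ≢ x → z ∈ (ys ─ x∈ys)
∈-─ (here refl) (here refl) z≢x = contradiction refl z≢x
∈-─ (here refl) (there z∈ys) _ = z∈ys
∈-─ (there x∈ys) (here refl) _ = here refl
∈-─ (there x∈ys) (there z∈ys) z≢x = there (∈-─ x∈ys z∈ys z≢x)

length-mono-⊆ : {xs ys : List A} → Unique xs → (∀ {z} → z ∈ xs → z ∈ ys) → length xs ≤ length ys
length-mono-⊆ [] _ = z≤n
length-mono-⊆ {xs = x ∷ xs} {ys} (x≢xs ∷ xs-unique) xs⊆ys =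
  subst (suc (length xs) ≤_) (sym (length-removeAt′ ys (Any.index x∈ys)))
    (s≤s (length-mono-⊆ xs-unique λ z∈xs →
      ∈-─ x∈ys (xs⊆ys (there z∈xs)) (λ z≡x → All.lookup x≢xs z∈xs (sym z≡x))))
  where x∈ys = xs⊆ys (here refl)

all-equal⇒length≤1 : {xs : List A} → Unique xs → (∀ {y z} → y ∈ xs → z ∈ xs → y ≡ z) → length xs ≤ 1
all-equal⇒length≤1 [] _ = z≤n
all-equal⇒length≤1 {xs = x ∷ xs} xs-unique all≡ =
  length-mono-⊆ {ys = x ∷ []} xs-unique (λ z∈ → here (all≡ z∈ (here refl)))

∣_∣ : SubsetV n → ℕ
∣_∣ {n} P = count P (allVecs n)

elements : SubsetV n → List (V n)
elements {n} P = filter (λ v → P v Bool.≟ true) (allVecs n)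

module _ {P : SubsetV n} where

  elements-unique : Unique (elements P)
  elements-unique = Unique.filter⁺ _ (allVecs-unique n)

  ∈-elements : ∀ {v} → P v ≡ true → v ∈ elements P
  ∈-elements {v} Pv = ∈-filter⁺ (λ v → P v Bool.≟ true) (∈-allVecs v) Pv

  elements-∈ : ∀ {v} → v ∈ elements P → P v ≡ true
  elements-∈ v∈ = proj₂ (∈-filter⁻ (λ v → P v Bool.≟ true) {xs = allVecs n} v∈)

injection⇒∣∣≤ : {P : SubsetV k} {Q : SubsetV m} (f : V k → V m) → (∀ {x y} → f x ≡ f y → x ≡ y) →
                    (∀ x → P x ≡ true → Q (f x) ≡ true) → ∣ P ∣ ≤ ∣ Q ∣
injection⇒∣∣≤ {P = P} {Q} f f-inj P⇒Qf =
  subst (_≤ ∣ Q ∣) (length-map f (elements P))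
    (length-mono-⊆ (Unique.map⁺ f-inj elements-unique) λ y∈ →
      let x , x∈ , y≡fx = ∈-map⁻ f y∈ in subst (_∈ elements Q) (sym y≡fx) (∈-elements (P⇒Qf x (elements-∈ x∈))))

surjection⇒∣∣≥ : {P : SubsetV k} {Q : SubsetV m} (f : V k → V m) →
                     (∀ y → Q y ≡ true → ∃ λ x → P x ≡ true × f x ≡ y) → ∣ Q ∣ ≤ ∣ P ∣
surjection⇒∣∣≥ {P = P} {Q} f f-onto =
  subst (∣ Q ∣ ≤_) (length-map f (elements P))
    (length-mono-⊆ elements-unique λ y∈ →
      let x , Px , fx≡y = f-onto _ (elements-∈ y∈) in subst (_∈ map f (elements P)) fx≡y (∈-map⁺ f (∈-elements Px)))

subsingleton⇒∣∣≤1 : {P : SubsetV n} → (∀ x y → P x ≡ true → P y ≡ true → x ≡ y) → ∣ P ∣ ≤ 1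
subsingleton⇒∣∣≤1 P-subsingleton =
  all-equal⇒length≤1 elements-unique λ x∈ y∈ → P-subsingleton _ _ (elements-∈ x∈) (elements-∈ y∈)

∣full∣ : ∀ n → ∣ (λ (_ : V n) → true) ∣ ≡ 2 ^ n
∣full∣ n = begin
  ∣ (λ (_ : V n) → true) ∣  ≡⟨ count≡∑χ _ (allVecs n) ⟩
  ∑ (allVecs n) (λ _ → 1)   ≡⟨ ∑-const (allVecs n) 1 ⟩
  1 * length (allVecs n)    ≡⟨ *-identityˡ _ ⟩
  length (allVecs n)        ≡⟨ length-allVecs n ⟩
  2 ^ n                     ∎
  where open ≡-Reasoning

∣∣-split : (P Q : SubsetV n) → ∣ P ∣ ≡ ∣ (λ v → P v ∧ Q v) ∣ + ∣ (λ v → P v ∧ not (Q v)) ∣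
∣∣-split {n} P Q = begin
  ∣ P ∣                                                 ≡⟨ count≡∑χ P (allVecs n) ⟩
  ∑ (allVecs n) (χ ∘ P)                                 ≡⟨ ∑-cong (allVecs n) (λ v → χ-split (P v) (Q v)) ⟩
  ∑ (allVecs n) (λ v → χ (P v ∧ Q v) + χ (P v ∧ not (Q v)))  ≡⟨ ∑-+ (allVecs n) _ _ ⟩
  ∑ (allVecs n) (λ v → χ (P v ∧ Q v)) + ∑ (allVecs n) (λ v → χ (P v ∧ not (Q v)))
    ≡⟨ cong₂ _+_ (count≡∑χ _ (allVecs n)) (count≡∑χ _ (allVecs n)) ⟨
  ∣ (λ v → P v ∧ Q v) ∣ + ∣ (λ v → P v ∧ not (Q v)) ∣   ∎
  where
  open ≡-Reasoning
  χ-split : ∀ a b → χ a ≡ χ (a ∧ b) + χ (a ∧ not b)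
  χ-split true true = refl
  χ-split true false = refl
  χ-split false b = refl

-- Dimension and subspace distance

2^-cancel-≤ : ∀ {a b} → 2 ^ a ≤ 2 ^ b → a ≤ b
2^-cancel-≤ 2^a≤2^b = ≮⇒≥ λ b<a → <⇒≱ (^-monoʳ-< 2 (s≤s (s≤s z≤n)) b<a) 2^a≤2^b

∣basis∣ : {S : SubsetV n} {bs : Vec (V n) k} → IsBasis S bs → ∣ S ∣ ≡ 2 ^ k
∣basis∣ {k = k} {bs = bs} (indep , spans) = trans (≤-antisym onto into) (∣full∣ k)
  where
  into = injection⇒∣∣≤ (λ c → lincomb c bs) (lincomb-injective indep _ _)
           (λ c _ → Equivalence.from (spans _) (c , refl))
  onto = surjection⇒∣∣≥ (λ c → lincomb c bs) (λ v Sv → let c , e = Equivalence.to (spans v) Sv in c , refl , e)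

spanning⇒dim≤ : {S : SubsetV n} (bs : Vec (V n) k) → (∀ v → S v ≡ true → Span bs v) → HasDim S m → m ≤ k
spanning⇒dim≤ {k = k} {m = m} {S = S} bs spans (cs , cs-basis) = 2^-cancel-≤ (begin
  2 ^ m                       ≡⟨ ∣basis∣ cs-basis ⟨
  ∣ S ∣                       ≤⟨ surjection⇒∣∣≥ (λ c → lincomb c bs) (λ v Sv → let c , e = spans v Sv in c , refl , e) ⟩
  ∣ (λ (_ : V k) → true) ∣    ≡⟨ ∣full∣ k ⟩
  2 ^ k                       ∎)
  where open ≤-Reasoning

dim-unique : {S : SubsetV n} → HasDim S k → HasDim S m → k ≡ m
dim-unique S-dim-k@(bs , _ , spans) S-dim-m@(cs , _ , spans′) =
  ≤-antisym (spanning⇒dim≤ cs (λ v → Equivalence.to (spans′ v)) S-dim-k)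
            (spanning⇒dim≤ bs (λ v → Equivalence.to (spans v)) S-dim-m)

module _ {U W : SubsetV n} where

  ∩-isSubspace : IsSubspace U → IsSubspace W → IsSubspace (U ∩ W)
  ∩-isSubspace U-sub W-sub = record
    { has-zero = cong₂ _∧_ (IsSubspace.has-zero U-sub) (IsSubspace.has-zero W-sub)
    ; add-closed = λ u w u∈ w∈ →
        cong₂ _∧_ (IsSubspace.add-closed U-sub u w (Bool.∧-conicalˡ _ _ u∈) (Bool.∧-conicalˡ _ _ w∈))
                  (IsSubspace.add-closed W-sub u w (Bool.∧-conicalʳ _ _ u∈) (Bool.∧-conicalʳ _ _ w∈)) }

  ⊕-elim : ∀ {v} → (U ⊕ W) v ≡ true → ∃ λ u → U u ≡ true × W (v +V u) ≡ true
  ⊕-elim {v} v∈ = let u , _ , e = any-elim (λ u → U u ∧ W (v +V u)) (allVecs n) v∈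
                  in u , Bool.∧-conicalˡ _ _ e , Bool.∧-conicalʳ _ _ e

  ⊕-intro : ∀ {u w} → U u ≡ true → W w ≡ true → (U ⊕ W) (u +V w) ≡ true
  ⊕-intro {u} {w} Uu Ww = any-intro (λ z → U z ∧ W ((u +V w) +V z)) (∈-allVecs u)
    (cong₂ _∧_ Uu (subst (λ z → W z ≡ true) (sym (+V-absorbˡ u w)) Ww))

  ⊕-isSubspace : IsSubspace U → IsSubspace W → IsSubspace (U ⊕ W)
  ⊕-isSubspace U-sub W-sub = record
    { has-zero = subst (λ z → (U ⊕ W) z ≡ true) (+V-self zeroV)
                   (⊕-intro (IsSubspace.has-zero U-sub) (IsSubspace.has-zero W-sub))
    ; add-closed = λ v₁ v₂ v₁∈ v₂∈ →
        let u₁ , Uu₁ , Ww₁ = ⊕-elim v₁∈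
            u₂ , Uu₂ , Ww₂ = ⊕-elim v₂∈
        in subst (λ z → (U ⊕ W) z ≡ true) (regroup v₁ v₂ u₁ u₂)
             (⊕-intro (IsSubspace.add-closed U-sub _ _ Uu₁ Uu₂) (IsSubspace.add-closed W-sub _ _ Ww₁ Ww₂)) }
    where
    regroup : ∀ v₁ v₂ u₁ u₂ → (u₁ +V u₂) +V ((v₁ +V u₁) +V (v₂ +V u₂)) ≡ v₁ +V v₂
    regroup v₁ v₂ u₁ u₂ = trans (+V-interchange u₁ u₂ (v₁ +V u₁) (v₂ +V u₂))
                                (cong₂ _+V_ (+V-absorbʳ u₁ v₁) (+V-absorbʳ u₂ v₂))

independent⇒≤dim : {S : SubsetV n} → IsSubspace S → {bs : Vec (V n) k} → LinIndep bs →
                   All (λ b → S b ≡ true) bs → HasDim S m → k ≤ m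
independent⇒≤dim {k = k} S-sub {bs} indep inS S-dim =
  let l , es , basis = BasisExtension.extend-to-basis S-sub bs indep inS
  in subst (k ≤_) (dim-unique (es ++ᵛ bs , basis) S-dim) (m≤n+m k l)

distinct-nonzero⇒LinIndep : {x y : V n} → x ≢ zeroV → y ≢ zeroV → x ≢ y → LinIndep (x ∷ y ∷ [])
distinct-nonzero⇒LinIndep {x = x} {y} x≢0 y≢0 x≢y = λ where
  (true ∷ true ∷ []) e → contradiction (+V≡0⇒≡ x y (trans (cong (x +V_) (sym (+V-identityʳ y))) e)) x≢y
  (true ∷ false ∷ []) e → contradiction (trans (sym (+V-identityʳ x)) (trans (cong (x +V_) (sym (+V-identityʳ zeroV))) e)) x≢0
  (false ∷ true ∷ []) e → contradiction (trans (sym (+V-identityʳ y)) (trans (sym (+V-identityˡ _)) e)) y≢0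
  (false ∷ false ∷ []) e → refl

⊕-spanned : {U W : SubsetV n} {a b c : ℕ} {eU : Vec (V n) a} {eW : Vec (V n) b} {bs : Vec (V n) c} →
            IsBasis U (eU ++ᵛ bs) → IsBasis W (eW ++ᵛ bs) → ∀ v → (U ⊕ W) v ≡ true → Span (eU ++ᵛ (eW ++ᵛ bs)) v
⊕-spanned {U = U} {W} {a} {b} {eU = eU} {eW} {bs} (_ , U-spans) (_ , W-spans) v v∈
  with u , Uu , Wv+u ← ⊕-elim {U = U} {W} v∈
  with cU , cU-ok ← Equivalence.to (U-spans u) Uu
  with cW , cW-ok ← Equivalence.to (W-spans (v +V u)) Wv+u
  with c₁ , c₂ , refl ← splitAt a cU
  with d₁ , d₂ , refl ← splitAt b cW
  = c₁ ++ᵛ (d₁ ++ᵛ (c₂ +V d₂)) , (begin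
    lincomb (c₁ ++ᵛ (d₁ ++ᵛ (c₂ +V d₂))) (eU ++ᵛ (eW ++ᵛ bs))
      ≡⟨ lincomb-++ c₁ _ eU _ ⟩
    lincomb c₁ eU +V lincomb (d₁ ++ᵛ (c₂ +V d₂)) (eW ++ᵛ bs)
      ≡⟨ cong (lincomb c₁ eU +V_) (trans (lincomb-++ d₁ _ eW bs) (cong (lincomb d₁ eW +V_) (lincomb-+ c₂ d₂ bs))) ⟩
    lincomb c₁ eU +V (lincomb d₁ eW +V (lincomb c₂ bs +V lincomb d₂ bs))
      ≡⟨ +V-assoc _ _ _ ⟨
    (lincomb c₁ eU +V lincomb d₁ eW) +V (lincomb c₂ bs +V lincomb d₂ bs)
      ≡⟨ +V-interchange _ _ _ _ ⟩
    (lincomb c₁ eU +V lincomb c₂ bs) +V (lincomb d₁ eW +V lincomb d₂ bs)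
      ≡⟨ cong₂ _+V_ (lincomb-++ c₁ c₂ eU bs) (lincomb-++ d₁ d₂ eW bs) ⟨
    lincomb (c₁ ++ᵛ c₂) (eU ++ᵛ bs) +V lincomb (d₁ ++ᵛ d₂) (eW ++ᵛ bs)
      ≡⟨ cong₂ _+V_ cU-ok cW-ok ⟩
    u +V (v +V u)
      ≡⟨ +V-absorbʳ u v ⟩
    v ∎)
  where open ≡-Reasoning

dist+2dim∩≤dim+dim : {U W : SubsetV n} {a b c d : ℕ} → IsSubspace U → IsSubspace W →
             HasDim U a → HasDim W b → HasDim (U ∩ W) c → DistAtLeast d U W → d + c + c ≤ a + b
dist+2dim∩≤dim+dim {a = a} {b} {c} {d} U-sub W-sub U-dim W-dim ∩-dim@(bs , ∩-basis) dist = begin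
  d + c + c             ≤⟨ +-monoˡ-≤ c (dist s c sum-dim ∩-dim) ⟩
  s + c                 ≤⟨ +-monoˡ-≤ c (spanning⇒dim≤ (eU ++ᵛ (eW ++ᵛ bs)) U⊕W-spanned sum-dim) ⟩
  mU + (mW + c) + c     ≡⟨ solve 3 (λ x y z → x :+ (y :+ z) :+ z := (x :+ z) :+ (y :+ z)) refl mU mW c ⟩
  (mU + c) + (mW + c)   ≡⟨ cong₂ _+_ (dim-unique (_ , U-basis) U-dim) (dim-unique (_ , W-basis) W-dim) ⟩
  a + b                 ∎
  where
  open ≤-Reasoning
  inU∩W = basis-All ∩-basis
  U-ext = BasisExtension.extend-to-basis U-sub bs (proj₁ ∩-basis) (VAll.map (Bool.∧-conicalˡ _ _) inU∩W)
  W-ext = BasisExtension.extend-to-basis W-sub bs (proj₁ ∩-basis) (VAll.map (Bool.∧-conicalʳ _ _) inU∩W)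
  mU = proj₁ U-ext
  eU = proj₁ (proj₂ U-ext)
  U-basis = proj₂ (proj₂ U-ext)
  mW = proj₁ W-ext
  eW = proj₁ (proj₂ W-ext)
  W-basis = proj₂ (proj₂ W-ext)
  sum = basis-exists (⊕-isSubspace U-sub W-sub)
  s = proj₁ sum
  sum-dim = proj₂ sum
  U⊕W-spanned = ⊕-spanned {eU = eU} {eW} {bs} U-basis W-basis

∩-nonzero-unique : {U W : SubsetV n} {a b d : ℕ} → a + b < d + 4 → IsSubspace U → IsSubspace W →
                   HasDim U a → HasDim W b → DistAtLeast d U W → ∀ {x y} → x ≢ zeroV → y ≢ zeroV →
                   (U ∩ W) x ≡ true → (U ∩ W) y ≡ true → x ≡ y
∩-nonzero-unique {d = d} a+b<d+4 U-sub W-sub U-dim W-dim dist {x} {y} x≢0 y≢0 x∈ y∈ with x ≟V y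
... | yes x≡y = x≡y
... | no x≢y = contradiction (≤-trans d+4≤d+c+c (dist+2dim∩≤dim+dim U-sub W-sub U-dim W-dim ∩-dim dist)) (<⇒≱ a+b<d+4)
  where
  ∩-sub = ∩-isSubspace U-sub W-sub
  c = proj₁ (basis-exists ∩-sub)
  ∩-dim = proj₂ (basis-exists ∩-sub)
  2≤c : 2 ≤ c
  2≤c = independent⇒≤dim ∩-sub (distinct-nonzero⇒LinIndep x≢0 y≢0 x≢y) (x∈ ∷ y∈ ∷ []) ∩-dim
  d+4≤d+c+c : d + 4 ≤ d + c + c
  d+4≤d+c+c = subst (_≤ d + c + c) (+-assoc d 2 2) (+-mono-≤ (+-monoʳ-≤ d 2≤c) 2≤c)

-- The second-moment bound

2m[m+k]≤m²+[m+k]² : ∀ m k → 2 * (m * (m + k)) ≤ m * m + (m + k) * (m + k)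
2m[m+k]≤m²+[m+k]² m k = subst (2 * (m * (m + k)) ≤_)
  (solve 2 (λ m k → con 2 :* (m :* (m :+ k)) :+ k :* k := m :* m :+ (m :+ k) :* (m :+ k)) refl m k)
  (m≤m+n _ (k * k))

2mn≤m²+n² : ∀ m n → 2 * (m * n) ≤ m * m + n * n
2mn≤m²+n² m n with ≤-total m n
... | inj₁ m≤n with k , refl ← m≤n⇒∃[o]m+o≡n m≤n = 2m[m+k]≤m²+[m+k]² m k
... | inj₂ n≤m with k , refl ← m≤n⇒∃[o]m+o≡n n≤m =
  subst₂ _≤_ (cong (2 *_) (*-comm n (n + k))) (+-comm (n * n) _) (2m[m+k]≤m²+[m+k]² n k)

module SecondMoment {I : Set} (_≟I_ : DecidableEquality I) (us : List A) (L : A → Bool) (S : I → A → Bool) where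

  size : I → ℕ
  size i = ∑ us (λ x → χ (L x ∧ S i x))

  shared : I → I → ℕ
  shared i j = ∑ us (λ x → χ (L x ∧ (S i x ∧ S j x)))

  module _ (K : List I) (K-unique : Unique K) (thin : ∀ {i j} → i ≢ j → shared i j ≤ 1) where

    pointwise : ∀ t (l : Bool) (a : I → Bool) →
                2 * (t * ∑ K (λ i → χ (l ∧ a i))) ≤ t * t * χ l + ∑ K (λ i → ∑ K (λ j → χ (l ∧ (a i ∧ a j))))
    pointwise t false a = subst (_≤ t * t * 0 + ∑ K (λ i → ∑ K (λ j → 0))) (sym lhs≡0) z≤n
      where lhs≡0 = trans (cong (λ r → 2 * (t * r)) (∑-zero K)) (cong (2 *_) (*-zeroʳ t))
    pointwise t true a = subst₂ (λ u v → 2 * (t * r) ≤ u + v) (sym (*-identityʳ (t * t))) (sym square) (2mn≤m²+n² t r)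
      where
      r = ∑ K (χ ∘ a)
      square : ∑ K (λ i → ∑ K (λ j → χ (a i ∧ a j))) ≡ r * r
      square = begin
        ∑ K (λ i → ∑ K (λ j → χ (a i ∧ a j)))      ≡⟨ ∑-cong K (λ i → ∑-cong K (λ j → χ-∧ (a i) (a j))) ⟩
        ∑ K (λ i → ∑ K (λ j → χ (a i) * χ (a j)))  ≡⟨ ∑-cong K (λ i → ∑-*ˡ K (χ (a i)) (χ ∘ a)) ⟩
        ∑ K (λ i → χ (a i) * r)                    ≡⟨ ∑-*ʳ K r (χ ∘ a) ⟩
        r * r                                      ∎
        where open ≡-Reasoning

    multiplicity≤1 : ∀ i → ∑ K (λ j → χ (does (i ≟I j))) ≤ 1
    multiplicity≤1 i = subst (_≤ 1) (count≡∑χ _ K)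
      (all-equal⇒length≤1 (Unique.filter⁺ _ K-unique) λ j∈ j′∈ → trans (sym (is-i j∈)) (is-i j′∈))
      where
      is-i : ∀ {j} → j ∈ filter (λ j → does (i ≟I j) Bool.≟ true) K → i ≡ j
      is-i {j} j∈ = from-does (i ≟I j) (proj₂ (∈-filter⁻ (λ j → does (i ≟I j) Bool.≟ true) {xs = K} j∈))

    shared≤ : ∀ i j → shared i j ≤ χ (does (i ≟I j)) * size i + 1
    shared≤ i j with i ≟I j
    ... | no i≢j = thin i≢j
    ... | yes refl = ≤-trans (≤-reflexive (trans diagonal (sym (+-identityʳ (size i))))) (m≤m+n _ 1)
      where diagonal = ∑-cong us (λ x → cong (λ b → χ (L x ∧ b)) (Bool.∧-idem (S i x)))

    row : ∀ i → ∑ K (shared i) ≤ size i + length K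
    row i = begin
      ∑ K (shared i)                                           ≤⟨ ∑-mono-≤ K (λ {j} _ → shared≤ i j) ⟩
      ∑ K (λ j → χ (does (i ≟I j)) * size i + 1)                ≡⟨ ∑-+ K _ _ ⟩
      ∑ K (λ j → χ (does (i ≟I j)) * size i) + ∑ K (λ _ → 1)    ≡⟨ cong₂ _+_ (∑-*ʳ K (size i) _) (trans (∑-const K 1) (*-identityˡ _)) ⟩
      ∑ K (λ j → χ (does (i ≟I j))) * size i + length K         ≤⟨ +-monoˡ-≤ (length K) (*-monoˡ-≤ (size i) (multiplicity≤1 i)) ⟩
      1 * size i + length K                                     ≡⟨ cong (_+ length K) (*-identityˡ (size i)) ⟩
      size i + length K                                         ∎
      where open ≤-Reasoning

    degree : A → ℕ
    degree x = ∑ K (λ i → χ (L x ∧ S i x))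

    pairs : A → ℕ
    pairs x = ∑ K (λ i → ∑ K (λ j → χ (L x ∧ (S i x ∧ S j x))))

    -- Double count over x ∈ us, using 2t·r ≤ t² + r² where r is the number of i ∈ K with x ∈ S i.
    second-moment-bound : ∀ t → 2 * (t * ∑ K size) ≤ t * t * ∑ us (χ ∘ L) + (∑ K size + length K * length K)
    second-moment-bound t = begin
      2 * (t * ∑ K size)                                ≡⟨ cong (λ z → 2 * (t * z)) (∑-swap K us _) ⟩
      2 * (t * ∑ us degree)                             ≡⟨ trans (∑-*ˡ us 2 _) (cong (2 *_) (∑-*ˡ us t degree)) ⟨
      ∑ us (λ x → 2 * (t * degree x))                   ≤⟨ ∑-mono-≤ us (λ {x} _ → pointwise t (L x) (λ i → S i x)) ⟩
      ∑ us (λ x → t * t * χ (L x) + pairs x)            ≡⟨ trans (∑-+ us _ pairs) (cong (_+ ∑ us pairs) (∑-*ˡ us (t * t) (χ ∘ L))) ⟩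
      t * t * ∑ us (χ ∘ L) + ∑ us pairs                 ≡⟨ cong (t * t * ∑ us (χ ∘ L) +_) pairs-swap ⟩
      t * t * ∑ us (χ ∘ L) + ∑ K (λ i → ∑ K (shared i))  ≤⟨ +-monoʳ-≤ (t * t * ∑ us (χ ∘ L)) (∑-mono-≤ K (λ {i} _ → row i)) ⟩
      t * t * ∑ us (χ ∘ L) + ∑ K (λ i → size i + length K)
        ≡⟨ cong (t * t * ∑ us (χ ∘ L) +_) (trans (∑-+ K size _) (cong (∑ K size +_) (∑-const K (length K)))) ⟩
      t * t * ∑ us (χ ∘ L) + (∑ K size + length K * length K)  ∎
      where
      open ≤-Reasoning
      pairs-swap : ∑ us pairs ≡ ∑ K (λ i → ∑ K (shared i))
      pairs-swap = trans (∑-swap us K _) (∑-cong K (λ i → ∑-swap us K _))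

isZero : V n → Bool
isZero v = does (v ≟V zeroV)

nonzero⇒≢0 : {v : V n} → not (isZero v) ≡ true → v ≢ zeroV
nonzero⇒≢0 {v = v} e v≡0 = contradiction (trans (sym e) (cong not (dec-true (v ≟V zeroV) v≡0))) λ ()

⟨_⟩ : V n → SubsetV n
⟨ v ⟩ w = isZero w ∨ does (w ≟V v)

module _ {v : V n} where

  ⟨⟩-elim : ∀ {w} → ⟨ v ⟩ w ≡ true → w ≡ zeroV ⊎ w ≡ v
  ⟨⟩-elim {w} e with w ≟V zeroV
  ... | yes w≡0 = inj₁ w≡0
  ... | no _ = inj₂ (from-does (w ≟V v) e)

  ⟨⟩-zero : ⟨ v ⟩ zeroV ≡ true
  ⟨⟩-zero = cong (_∨ does (zeroV ≟V v)) (dec-true (zeroV {n} ≟V zeroV) refl)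

  ⟨⟩-self : ⟨ v ⟩ v ≡ true
  ⟨⟩-self = trans (cong (isZero v ∨_) (dec-true (v ≟V v) refl)) (Bool.∨-zeroʳ (isZero v))

  ⟨⟩-isPoint : v ≢ zeroV → IsPoint ⟨ v ⟩
  ⟨⟩-isPoint v≢0 = record { has-zero = ⟨⟩-zero ; add-closed = add-closed } , (v ∷ [] , indep , spans)
    where
    ⟨v⟩∋ : V n → Set
    ⟨v⟩∋ w = ⟨ v ⟩ w ≡ true
    add-closed : ∀ w₁ w₂ → ⟨v⟩∋ w₁ → ⟨v⟩∋ w₂ → ⟨v⟩∋ (w₁ +V w₂)
    add-closed w₁ w₂ e₁ e₂ with ⟨⟩-elim {w₁} e₁ | ⟨⟩-elim {w₂} e₂
    ... | inj₁ refl | inj₁ refl = subst ⟨v⟩∋ (sym (+V-self zeroV)) ⟨⟩-zero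
    ... | inj₁ refl | inj₂ refl = subst ⟨v⟩∋ (sym (+V-identityˡ v)) ⟨⟩-self
    ... | inj₂ refl | inj₁ refl = subst ⟨v⟩∋ (sym (+V-identityʳ v)) ⟨⟩-self
    ... | inj₂ refl | inj₂ refl = subst ⟨v⟩∋ (sym (+V-self v)) ⟨⟩-zero
    indep : LinIndep (v ∷ [])
    indep (true ∷ []) e = contradiction (trans (sym (+V-identityʳ v)) e) v≢0
    indep (false ∷ []) e = refl
    spans : ∀ w → ⟨v⟩∋ w ⇔ Span (v ∷ []) w
    spans w = mk⇔ (λ e → [ (λ w≡0 → false ∷ [] , trans (+V-identityˡ zeroV) (sym w≡0))
                         , (λ w≡v → true ∷ [] , trans (+V-identityʳ v) (sym w≡v)) ]′ (⟨⟩-elim e))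
      λ { (true ∷ [] , e) → subst ⟨v⟩∋ (trans (sym (+V-identityʳ v)) e) ⟨⟩-self
        ; (false ∷ [] , e) → subst ⟨v⟩∋ (trans (sym (+V-identityˡ zeroV)) e) ⟨⟩-zero }

module _ {U X : SubsetV n} where

  ≤ᵇ⇒≤S : (U ≤ᵇ X) ≡ true → U ≤S X
  ≤ᵇ⇒≤S U≤X v Uv = subst (λ b → not b ∨ X v ≡ true) Uv (all-elim (λ w → not (U w) ∨ X w) U≤X (∈-allVecs v))

  ≤S⇒≤ᵇ : U ≤S X → (U ≤ᵇ X) ≡ true
  ≤S⇒≤ᵇ U≤X = all-intro (λ w → not (U w) ∨ X w) (allVecs n) (λ {v} _ → pointwise v)
    where
    pointwise : ∀ v → not (U v) ∨ X v ≡ true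
    pointwise v with U v in Uv
    ... | true = U≤X v Uv
    ... | false = refl

  ≰ᵇ⇒witness : (U ≤ᵇ X) ≡ false → ∃ λ v → U v ≡ true × X v ≡ false
  ≰ᵇ⇒witness U≰X with all≡false⇒∃ (λ w → not (U w) ∨ X w) (allVecs n) U≰X
  ... | v , e with U v in Uv | X v in Xv
  ...   | true | false = v , Uv , Xv

⟨⟩≤ᵇ : {U : SubsetV n} {v : V n} → IsSubspace U → U v ≡ true → (⟨ v ⟩ ≤ᵇ U) ≡ true
⟨⟩≤ᵇ {U = U} {v} U-sub Uv = ≤S⇒≤ᵇ {U = ⟨ v ⟩} {U} λ w e →
  [ (λ { refl → IsSubspace.has-zero U-sub }) , (λ { refl → Uv }) ]′ (⟨⟩-elim {w = w} e)

∣∣-nonzero : {U : SubsetV n} → IsSubspace U → ∣ U ∣ ≡ suc ∣ (λ v → U v ∧ not (isZero v)) ∣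
∣∣-nonzero {n} {U = U} U-sub =
  trans (∣∣-split U isZero) (cong (_+ ∣ (λ v → U v ∧ not (isZero v)) ∣) (≤-antisym at-most-zero at-least-zero))
  where
  at-most-zero : ∣ (λ v → U v ∧ isZero v) ∣ ≤ 1
  at-most-zero = subsingleton⇒∣∣≤1 {P = λ v → U v ∧ isZero v} λ x y x∈ y∈ →
    trans (from-does (x ≟V zeroV) (Bool.∧-conicalʳ _ _ x∈)) (sym (from-does (y ≟V zeroV) (Bool.∧-conicalʳ _ _ y∈)))
  at-least-zero : 1 ≤ ∣ (λ v → U v ∧ isZero v) ∣
  at-least-zero = subst (_≤ ∣ (λ v → U v ∧ isZero v) ∣) (∣full∣ 0)
    (injection⇒∣∣≤ {P = λ (_ : V 0) → true} {Q = λ v → U v ∧ isZero v}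
      (λ _ → zeroV) (λ { {[]} {[]} _ → refl })
      (λ _ _ → cong₂ _∧_ (IsSubspace.has-zero U-sub) (dec-true (zeroV {n} ≟V zeroV) refl)))

half-outside : {U H : SubsetV n} → IsSubspace U → IsSubspace H → (U ≤ᵇ H) ≡ false →
               ∣ U ∣ ≤ 2 * ∣ (λ v → U v ∧ not (H v)) ∣
half-outside {U = U} {H} U-sub H-sub U≰H = begin
  ∣ U ∣                                                        ≡⟨ ∣∣-split U H ⟩
  ∣ (λ v → U v ∧ H v) ∣ + ∣ (λ v → U v ∧ not (H v)) ∣         ≤⟨ +-monoˡ-≤ _ shift ⟩
  ∣ (λ v → U v ∧ not (H v)) ∣ + ∣ (λ v → U v ∧ not (H v)) ∣   ≡⟨ cong (∣ (λ v → U v ∧ not (H v)) ∣ +_) (+-identityʳ _) ⟨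
  2 * ∣ (λ v → U v ∧ not (H v)) ∣                             ∎
  where
  open ≤-Reasoning
  witness = ≰ᵇ⇒witness {U = U} {H} U≰H
  u = proj₁ witness
  Uu = proj₁ (proj₂ witness)
  Hu = proj₂ (proj₂ witness)
  shift : ∣ (λ v → U v ∧ H v) ∣ ≤ ∣ (λ v → U v ∧ not (H v)) ∣
  shift = injection⇒∣∣≤ (_+V u)
    (λ {x} {y} e → +V-cancelˡ-≡ u x y (trans (+V-comm u x) (trans e (+V-comm y u))))
    λ w w∈ → cong₂ _∧_ (IsSubspace.add-closed U-sub w u (Bool.∧-conicalˡ _ _ w∈) Uu)
                       (H-misses w (Bool.∧-conicalʳ _ _ w∈))
    where
    H-misses : ∀ w → H w ≡ true → not (H (w +V u)) ≡ true
    H-misses w Hw with H (w +V u) in Hw+u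
    ... | false = refl
    ... | true = contradiction (trans (sym Hu) H∋u) λ ()
      where H∋u = subst (λ z → H z ≡ true) (+V-absorbˡ w u) (IsSubspace.add-closed H-sub _ _ Hw+u Hw)

countI-⟨⟩-≥ : (C : List (SubsetV n)) → (∀ i → IsSubspace (lookup C i)) → ∀ v →
              ∑ (allFin (length C)) (λ i → χ (lookup C i v)) ≤ countI C ⟨ v ⟩
countI-⟨⟩-≥ C C-sub v = subst (∑ (allFin (length C)) (λ i → χ (lookup C i v)) ≤_) (sym (count-lookup _ C))
  (∑-mono-≤ (allFin (length C)) (λ {i} _ → through i))
  where
  through : ∀ i → χ (lookup C i v) ≤ χ (lookup C i ≤ᵇ ⟨ v ⟩ ∨ ⟨ v ⟩ ≤ᵇ lookup C i)
  through i with lookup C i v in Uv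
  ... | false = z≤n
  ... | true = ≤-reflexive (cong χ (sym (trans (cong (lookup C i ≤ᵇ ⟨ v ⟩ ∨_) (⟨⟩≤ᵇ (C-sub i) Uv))
                                              (Bool.∨-zeroʳ _))))

-- Codewords and a hyperplane

-- The contradiction behind "at most 25 codewords lie in a hyperplane": with t = 4 the
-- second-moment bound reads 7 S ≤ 2708, while 26 codewords give S ≥ 26 · 15 = 390.
second-moment-bound-fails-at-26 : ∀ S c → 390 ≤ S → c ≤ 127 → ¬ (2 * (4 * S) ≤ 4 * 4 * c + (S + 26 * 26))
second-moment-bound-fails-at-26 S c 390≤S c≤127 bound = 2730≰2708 (≤-trans (*-monoʳ-≤ 7 390≤S) 7S≤2708)
  where
  2730≰2708 : ¬ (2730 ≤ 2708)
  2730≰2708 = ≤⇒≤ᵇ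
  7S≤2708 : 7 * S ≤ 2708
  7S≤2708 = +-cancelˡ-≤ S _ _ (begin
    S + 7 * S                      ≡⟨ solve 1 (λ s → s :+ con 7 :* s := con 2 :* (con 4 :* s)) refl S ⟩
    2 * (4 * S)                    ≤⟨ bound ⟩
    4 * 4 * c + (S + 26 * 26)      ≤⟨ +-monoˡ-≤ (S + 26 * 26) (*-monoʳ-≤ 16 c≤127) ⟩
    2032 + (S + 676)               ≡⟨ solve 1 (λ s → con 2032 :+ (s :+ con 676) := s :+ con 2708) refl S ⟩
    S + 2708                       ∎)
    where open ≤-Reasoning

module CodeAndHyperplane (C : List (SubsetV 8)) (code : IsCode C) (big : 255 ≤ length C)
                         (H : SubsetV 8) (H-hyp : IsHyperplane8 H) where

  N : ℕ
  N = length C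

  U : Fin N → SubsetV 8
  U = lookup C

  U-sub : ∀ i → IsSubspace (U i)
  U-sub i = proj₁ (proj₁ code i)

  U-dim : ∀ i → HasDim (U i) 4
  U-dim i = proj₂ (proj₁ code i)

  ∣U∣ : ∀ i → ∣ U i ∣ ≡ 16
  ∣U∣ i = ∣basis∣ (proj₂ (U-dim i))

  H-sub : IsSubspace H
  H-sub = proj₁ H-hyp

  ∣H∣ : ∣ H ∣ ≡ 128
  ∣H∣ = ∣basis∣ (proj₂ (proj₂ H-hyp))

  L : SubsetV 8
  L v = H v ∧ not (isZero v)

  inside : Fin N → Bool
  inside i = U i ≤ᵇ H

  open SecondMoment Fin._≟_ (allVecs 8) L U

  ∣L∣ : ∣ L ∣ ≡ 127
  ∣L∣ = suc-injective (trans (sym (∣∣-nonzero H-sub)) ∣H∣)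

  size≥15 : ∀ i → inside i ≡ true → 15 ≤ size i
  size≥15 i in-H = begin
    15                                      ≡⟨ suc-injective (trans (sym (∣U∣ i)) (∣∣-nonzero (U-sub i))) ⟩
    ∣ (λ v → U i v ∧ not (isZero v)) ∣      ≤⟨ injection⇒∣∣≤ id id nonzero-in-L ⟩
    ∣ (λ v → L v ∧ U i v) ∣                 ≡⟨ count≡∑χ (λ v → L v ∧ U i v) (allVecs 8) ⟩
    size i                                  ∎
    where
    open ≤-Reasoning
    nonzero-in-L : ∀ v → U i v ∧ not (isZero v) ≡ true → L v ∧ U i v ≡ true
    nonzero-in-L v e = let Uv = Bool.∧-conicalˡ (U i v) _ e in
      cong₂ _∧_ (cong₂ _∧_ (≤ᵇ⇒≤S {U = U i} {H} in-H v Uv) (Bool.∧-conicalʳ (U i v) _ e)) Uv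

  shared≤1 : ∀ {i j} → i ≢ j → shared i j ≤ 1
  shared≤1 {i} {j} i≢j = subst (_≤ 1) (count≡∑χ (λ v → L v ∧ (U i v ∧ U j v)) (allVecs 8))
    (subsingleton⇒∣∣≤1 λ x y x∈ y∈ →
      ∩-nonzero-unique (≤ᵇ⇒≤ 9 10 _) (U-sub i) (U-sub j) (U-dim i) (U-dim j) (proj₂ code i j i≢j)
        (nonzero x x∈) (nonzero y y∈) (Bool.∧-conicalʳ (L x) _ x∈) (Bool.∧-conicalʳ (L y) _ y∈))
    where
    nonzero : ∀ v → L v ∧ (U i v ∧ U j v) ≡ true → v ≢ zeroV
    nonzero v e = nonzero⇒≢0 (Bool.∧-conicalʳ (H v) _ (Bool.∧-conicalˡ (L v) _ e))

  no-26-inside : (K : List (Fin N)) → Unique K → (∀ {i} → i ∈ K → inside i ≡ true) → length K ≡ 26 → ⊥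
  no-26-inside K K-unique K-inside ∣K∣≡26 =
    second-moment-bound-fails-at-26 (∑ K size) (∑ (allVecs 8) (χ ∘ L)) many-incidences
      (≤-reflexive (trans (sym (count≡∑χ L (allVecs 8))) ∣L∣))
      (subst (λ k → 2 * (4 * ∑ K size) ≤ 4 * 4 * ∑ (allVecs 8) (χ ∘ L) + (∑ K size + k * k)) ∣K∣≡26
        (second-moment-bound K K-unique shared≤1 4))
    where
    many-incidences : 390 ≤ ∑ K size
    many-incidences = subst (_≤ ∑ K size) (trans (∑-const K 15) (cong (15 *_) ∣K∣≡26))
                        (∑-mono-≤ K (λ i∈ → size≥15 _ (K-inside i∈)))

  few-inside : count inside (allFin N) ≤ 25
  few-inside with count inside (allFin N) ≤? 25
  ... | yes few = few
  ... | no many = ⊥-elim (no-26-inside (take 26 J) (Unique.take⁺ 26 (Unique.filter⁺ _ (Unique.allFin⁺ N)))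
                    (λ i∈ → proj₂ (∈-filter⁻ _ {xs = allFin N} (Sublist.lookup (take-⊆ 26 J) i∈)))
                    (trans (length-take 26 J) (m≤n⇒m⊓n≡m (≰⇒> many))))
    where J = filter (λ i → inside i Bool.≟ true) (allFin N)

  many-outside : 230 ≤ count (not ∘ inside) (allFin N)
  many-outside = +-cancelˡ-≤ 25 _ _ (begin
    255                                                        ≤⟨ big ⟩
    N                                                          ≡⟨ length-tabulate id ⟨
    length (allFin N)                                          ≡⟨ count-complement inside (allFin N) ⟨
    count inside (allFin N) + count (not ∘ inside) (allFin N)  ≤⟨ +-monoˡ-≤ _ few-inside ⟩
    25 + count (not ∘ inside) (allFin N)                       ∎)
    where open ≤-Reasoning

  outside : Fin N → SubsetV 8
  outside i v = U i v ∧ not (H v)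

  outside≥8 : ∀ i → 8 * χ (not (inside i)) ≤ ∣ outside i ∣
  outside≥8 i with inside i in U≰H
  ... | true = z≤n
  ... | false = *-cancelˡ-≤ 2 (subst (_≤ 2 * ∣ outside i ∣) (∣U∣ i) (half-outside (U-sub i) H-sub U≰H))

  codewords-outside-through : V 8 → ℕ
  codewords-outside-through v = ∑ (allFin N) (λ i → χ (outside i v))

  outside-incidences : 1840 ≤ ∑ (allVecs 8) codewords-outside-through
  outside-incidences = begin
    8 * 230                                              ≤⟨ *-monoʳ-≤ 8 many-outside ⟩
    8 * count (not ∘ inside) (allFin N)                  ≡⟨ cong (8 *_) (count≡∑χ (not ∘ inside) (allFin N)) ⟩
    8 * ∑ (allFin N) (χ ∘ not ∘ inside)                  ≡⟨ ∑-*ˡ (allFin N) 8 (χ ∘ not ∘ inside) ⟨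
    ∑ (allFin N) (λ i → 8 * χ (not (inside i)))          ≤⟨ ∑-mono-≤ (allFin N) (λ {i} _ → outside≥8 i) ⟩
    ∑ (allFin N) (λ i → ∣ outside i ∣)                   ≡⟨ ∑-cong (allFin N) (λ i → count≡∑χ (outside i) (allVecs 8)) ⟩
    ∑ (allFin N) (λ i → ∑ (allVecs 8) (χ ∘ outside i))   ≡⟨ ∑-swap (allFin N) (allVecs 8) (λ i v → χ (outside i v)) ⟩
    ∑ (allVecs 8) codewords-outside-through              ∎
    where open ≤-Reasoning

  ∣H∁∣ : ∣ (not ∘ H) ∣ ≡ 128
  ∣H∁∣ = +-cancelˡ-≡ 128 ∣ (not ∘ H) ∣ 128 (begin
    128 + ∣ (not ∘ H) ∣     ≡⟨ cong (λ h → h + ∣ (not ∘ H) ∣) ∣H∣ ⟨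
    ∣ H ∣ + ∣ (not ∘ H) ∣   ≡⟨ ∣∣-split (λ _ → true) H ⟨
    ∣ (λ (_ : V 8) → true) ∣ ≡⟨ ∣full∣ 8 ⟩
    256                     ∎)
    where open ≡-Reasoning

  capacity-outside : ∑ (allVecs 8) (λ v → 14 * χ (not (H v))) ≡ 1792
  capacity-outside = trans (∑-*ˡ (allVecs 8) 14 (χ ∘ not ∘ H))
                           (cong (14 *_) (trans (sym (count≡∑χ (not ∘ H) (allVecs 8))) ∣H∁∣))

  rich-point : ∃ λ v → H v ≡ false × 15 ≤ ∑ (allFin N) (λ i → χ (U i v))
  rich-point =
    let v , _ , lt = ∑-<⇒∃< (allVecs 8) (λ v → 14 * χ (not (H v))) codewords-outside-through
                       (subst (_< ∑ (allVecs 8) codewords-outside-through) (sym capacity-outside)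
                         (<-≤-trans (≤ᵇ⇒≤ 1793 1840 _) outside-incidences))
    in v , through (H v) (λ i → U i v) lt
    where
    through : (h : Bool) (a : Fin N → Bool) → 14 * χ (not h) < ∑ (allFin N) (λ i → χ (a i ∧ not h)) →
              h ≡ false × 15 ≤ ∑ (allFin N) (χ ∘ a)
    through true a lt =
      contradiction (trans (∑-cong (allFin N) (λ i → cong χ (Bool.∧-zeroʳ (a i)))) (∑-zero (allFin N))) (>⇒≢ lt)
    through false a lt = refl , subst (15 ≤_) (∑-cong (allFin N) (λ i → cong χ (Bool.∧-identityʳ (a i)))) lt

rich-point-off-hyperplane : (C : List (SubsetV 8)) → IsCode C → 255 ≤ length C → (H : SubsetV 8) → IsHyperplane8 H →
                            ∃ λ P → IsPoint P × ¬ (P ≤S H) × 15 ≤ countI C P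
rich-point-off-hyperplane C code big H H-hyp =
  ⟨ v ⟩ , ⟨⟩-isPoint v≢0 , (λ ⟨v⟩≤H → contradiction (trans (sym (⟨v⟩≤H v (⟨⟩-self {v = v}))) Hv≡false) λ ())
        , ≤-trans 15≤ (countI-⟨⟩-≥ C U-sub v)
  where
  open CodeAndHyperplane C code big H H-hyp using (U-sub; H-sub; rich-point)
  v = proj₁ rich-point
  Hv≡false = proj₁ (proj₂ rich-point)
  15≤ = proj₂ (proj₂ rich-point)
  v≢0 : v ≢ zeroV
  v≢0 v≡0 = contradiction (trans (sym (subst (λ w → H w ≡ true) (sym v≡0) (IsSubspace.has-zero H-sub))) Hv≡false) λ ()

mainTheorem5 : (C : List (SubsetV 8)) → IsCode C → 255 ≤ length C →
    ((H : SubsetV 8) → IsHyperplane8 H →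
       ∃ λ P → IsPoint P × ¬ (P ≤S H) × 14 ≤ countI C P)
    × (((P : SubsetV 8) → IsPoint P → countI C P ≤ 16) →
       (H : SubsetV 8) → IsHyperplane8 H →
         ∃ λ P → IsPoint P × ¬ (P ≤S H) × 15 ≤ countI C P)
mainTheorem5 C code big =
  (λ H H-hyp → let P , P-point , P≰H , 15≤ = rich-point-off-hyperplane C code big H H-hyp
               in P , P-point , P≰H , ≤-trans (n≤1+n 14) 15≤) ,
  -- The bound 15 holds without the hypothesis #I_C(P) ≤ 16.
  (λ _ → rich-point-off-hyperplane C code big)
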